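{- Let $\mathcal G$ be the Le-graph associated to a Le-diagram $L$ (of a positroid cell in $Gr^{\mathrm{TNN}}(k,n)$), with its canonical acyclic perfect orientation whose source set is the pivot set $I$. Then the master signature $\epsilon^{\mathrm{mas}}$ on $\mathcal G$ is of geometric type, i.e. it is equivalent to the geometric signature of $(\mathcal G,\mathcal O,\mathfrak l)$ for the canonical orientation $\mathcal O$ and a suitable gauge ray direction $\mathfrak l$.
   Context: Young diagram and Le-diagram: for $I=\{i_1<\dots<i_k\}\subset[n]$, $\bar I=[n]\setminus I$, consider the lattice path in the $k\times(n-k)$ rectangle from its NE corner to its SW corner whose $s$-th step ($s=1,\dots,n$) is a vertical unit step if $s\in I$ and a horizontal unit step if $s\notin I$; the Young diagram is the region NW of this path. Its rows are indexed by $I$ (the row of $i$ ends at the $i$-th, vertical, step) and its columns by $\bar I$ (the column of $j$ ends at the $j$-th, horizontal, step); $B_{ij}$ denotes the box in row $i\in I$ and column $j\in\bar I$. A Le-diagram is a filling of the boxes with $0$'s and $1$'s such that for any three boxes $B_{ik},B_{lk},B_{lj}$ with $i<l$ and $k<j$, if $B_{ik}$ and $B_{lj}$ contain nonzero entries then so does $B_{lk}$. A Le-tableau replaces the $1$'s by positive weights $w_{ij}$. Le-graph/network: put a white vertex $V_i$ at the $i$-th vertical boundary step and a boundary source $b_i$ for each $i\in I$, and a boundary sink $b_j$ at each $j$-th horizontal step, $j\in\bar I$; deform the boundary containing the $b$'s to a horizontal line. Add a vertical edge of weight $1$ from $b_i$ to $V_i$. For each box $B_{ij}$ with weight $w_{ij}>0$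 place inside it a black vertex $V'_{ij}$ and a white vertex $V_{ij}$ to its left, with all internal vertices of row $i$ (including $V_i$) on a common horizontal line, and add: a horizontal edge of weight $1$ directed from $V'_{ij}$ to $V_{ij}$; a horizontal edge of weight $w_{ij}$ directed from $V_{i,l}$ to $V'_{ij}$, where $V_{i,l}$ is the first white vertex on the same horizontal line to the right ($V_i$ if there is none); a vertical edge of weight $1$ directed downwards from $V_{ij}$ to $b_j$ if all boxes below $B_{ij}$ in its column are empty, and otherwise to $V'_{lj}$, where $B_{lj}$ is the first filled box below $B_{ij}$. This orientation is the canonical one. Master signature: $\epsilon^{\mathrm{mas}}_e=0$ for a horizontal edge from a white to a black vertex; $1$ for a horizontal edge from a black to a white vertex; $0$ for an edge starting at a boundary source; $\#(I\cap(i,l])\bmod 2$ for a vertical edge $(V_{ij},V'_{lj})$ between internal vertices; $\#(I\cap(i,j))\bmod 2$ for a vertical edge $(V_{ij},b_j)$ ending at a boundary sink. Signature equivalence: signatures $\epsilon,\hat\epsilon$ are equivalent if there is $\eta:\{\text{internal vertices}\}\to\{0,1\}$ with $\hat\epsilon_{U,V}\equiv\epsilon_{U,V}+\eta(U)+\eta(V)$ on edges between internal vertices and $\hat\epsilon_{U,V}\equiv\epsilon_{U,V}+\eta(U)$ on edges from an internal $U$ to a boundary vertex $V$ (mod 2). Geometric signature: a gauge ray direction is a direction $\mathfrak l$ such that rays from boundary vertices in direction $\mathfrak l$ enter the disc, no edge is parallel to $\mathfrak l$, and no such ray passes through an internal vertex. $s(f,g)=1,0,-1$ according as $\det(f,g)>0,=0,<0$.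 $\mathrm{wind}(e,f)=1$ if $s(e,f)=s(e,\mathfrak l)=s(\mathfrak l,f)=1$, $-1$ if all are $-1$, else $0$. $\mathrm{int}(e)$ is the number of intersections of $e$ with the rays from the boundary sources in direction $\mathfrak l$, times $s(\mathfrak l,e)$. The geometric signature is (mod 2): for $e$ from internal $V$ to a sink: $\mathrm{int}(e)$ if $V$ black, $1+\mathrm{int}(e)+\mathrm{wind}(e_1,e)$ if $V$ white with incoming $e_1$; for $e$ from a source to internal $V$: $1+\mathrm{int}(e)+\mathrm{wind}(e,e')$ if $V$ black with outgoing $e'$, $1+\mathrm{int}(e)$ if $V$ white; for internal $e=(U,V)$: $\mathrm{int}(e)$ ($U$ black, $V$ white); $1+\mathrm{int}(e)+\mathrm{wind}(e_1,e)$ ($U,V$ white, $e_1$ incoming at $U$); $1+\mathrm{int}(e)+\mathrm{wind}(e_1,e)+\mathrm{wind}(e,e_5)$ ($U$ white, $V$ black, $e_1$ incoming at $U$, $e_5$ outgoing at $V$); $\mathrm{int}(e)+\mathrm{wind}(e,e_5)$ ($U,V$ black, $e_5$ outgoing at $V$). -}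

module Defs where

open import Data.Bool using (Bool; true; false; _∧_; _∨_; not; if_then_else_; _xor_)
open import Data.Nat as ℕ using (ℕ; zero; suc; _<ᵇ_; _≤ᵇ_)
open import Data.Fin using (Fin; toℕ)
open import Data.List using (List; []; _∷_; _++_; length; filterᵇ; concatMap; last; head; allFin; cartesianProduct)
open import Data.List.Relation.Unary.All using (All)
open import Data.Maybe using (Maybe; just; nothing)
open import Data.Integer as ℤ using (ℤ; +_; -[1+_]; -_; _+_; _-_; _*_; ∣_∣)
open import Data.Product using (_×_; _,_; proj₁; proj₂; Σ)
open import Relation.Binary.PropositionalEquality using (_≡_; _≢_)

-- Basic combinatorics.  [n] is modelled by Fin n (0-based; only the
-- linear order matters).  Subsets of [n] are predicates  Fin n → Bool.

infix 4 _<F_ _≤F_ _==F_ _==V_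

_<F_ : ∀ {n} → Fin n → Fin n → Bool
a <F b = toℕ a <ᵇ toℕ b

_≤F_ : ∀ {n} → Fin n → Fin n → Bool
a ≤F b = toℕ a ≤ᵇ toℕ b

_==F_ : ∀ {n} → Fin n → Fin n → Bool
a ==F b = (a ≤F b) ∧ (b ≤F a)

odd : ℕ → Bool
odd zero    = false
odd (suc m) = not (odd m)

card : ∀ {n} → (Fin n → Bool) → ℕ
card {n} P = length (filterᵇ P (allFin n))

-- I is the pivot set, L a 0/1 filling.  The box B_ij
-- exists iff i ∈ I, j ∉ I and i < j; a box is "filled" iff it exists
-- and L puts a 1 in it (values of L outside the diagram are ignored).

filled : ∀ {n} → (Fin n → Bool) → (Fin n → Fin n → Bool) → Fin n → Fin n → Bool
filled I L i j = I i ∧ not (I j) ∧ (i <F j) ∧ L i j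

IsLeDiagram : ∀ {n} → (Fin n → Bool) → (Fin n → Fin n → Bool) → Set
IsLeDiagram {n} I L = (i l k j : Fin n) → (i <F l) ≡ true → (k <F j) ≡ true →
  (l <F k) ≡ true → filled I L i k ≡ true → filled I L l j ≡ true →
  filled I L l k ≡ true

data Vtx (n : ℕ) : Set where
  bnd : Fin n → Vtx n
  vI  : Fin n → Vtx n            -- white vertex V_i (i ∈ I)
  wht : Fin n → Fin n → Vtx n    -- white vertex V_ij
  blk : Fin n → Fin n → Vtx n    -- black vertex V'_ij

data Colour : Set where
  boundary white black : Colour

colour : ∀ {n} → Vtx n → Colour
colour (bnd _)   = boundary
colour (vI _)    = white
colour (wht _ _) = white
colour (blk _ _) = black

internal : ∀ {n} → Vtx n → Bool
internal (bnd _) = false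
internal _       = true

_==V_ : ∀ {n} → Vtx n → Vtx n → Bool
bnd a   ==V bnd b   = a ==F b
vI a    ==V vI b    = a ==F b
wht a b ==V wht c d = (a ==F c) ∧ (b ==F d)
blk a b ==V blk c d = (a ==F c) ∧ (b ==F d)
_       ==V _       = false

data Edge (n : ℕ) : Set where
  src : Fin n → Edge n
  bw  : Fin n → Fin n → Edge n
  hor : Vtx n → Fin n → Fin n → Edge n   -- (V_{i,l} or V_i) → V'_ij
  ver : Fin n → Fin n → Fin n → Edge n   -- ver i l j : V_ij → V'_lj
  snk : Fin n → Fin n → Edge n

tl : ∀ {n} → Edge n → Vtx n
tl (src i)     = bnd i
tl (bw i j)    = blk i j
tl (hor w i j) = w
tl (ver i l j) = wht i j
tl (snk i j)   = wht i j

hd : ∀ {n} → Edge n → Vtx n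
hd (src i)     = vI i
hd (bw i j)    = wht i j
hd (hor w i j) = blk i j
hd (ver i l j) = blk l j
hd (snk i j)   = bnd j

module _ {n : ℕ} (I : Fin n → Bool) (L : Fin n → Fin n → Bool) where

  -- first white vertex to the right of V'_ij on row i
  rightWhite : Fin n → Fin n → Vtx n
  rightWhite i j with last (filterᵇ (λ l → filled I L i l ∧ (l <F j)) (allFin n))
  ... | just l  = wht i l
  ... | nothing = vI i

  -- downward edge out of V_ij
  downEdge : Fin n → Fin n → Edge n
  downEdge i j with head (filterᵇ (λ l → (i <F l) ∧ filled I L l j) (allFin n))
  ... | just l  = ver i l j
  ... | nothing = snk i j

  boxEdges : Fin n × Fin n → List (Edge n)
  boxEdges (i , j) = if filled I L i j
    then bw i j ∷ hor (rightWhite i j) i j ∷ downEdge i j ∷ []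
    else []

  srcEdges : Fin n → List (Edge n)
  srcEdges i = if I i then src i ∷ [] else []

  leEdges : List (Edge n)
  leEdges = concatMap srcEdges (allFin n)
            ++ concatMap boxEdges (cartesianProduct (allFin n) (allFin n))

-- Master signature (values in Z/2 = Bool).

master : ∀ {n} → (Fin n → Bool) → Edge n → Bool
master I (src i)     = false
master I (bw i j)    = true
master I (hor w i j) = false
master I (ver i l j) = odd (card (λ m → I m ∧ (i <F m) ∧ (m ≤F l)))
master I (snk i j)   = odd (card (λ m → I m ∧ (i <F m) ∧ (m <F j)))

SigEquiv : ∀ {n} → List (Edge n) → (Edge n → Bool) → (Edge n → Bool) → Set
SigEquiv {n} G ε ε̂ = Σ (Vtx n → Bool) λ η →
  All (λ e → ε̂ e ≡ ((ε e xor ηb η (tl e)) xor ηb η (hd e))) G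
  where
  ηb : (Vtx n → Bool) → Vtx n → Bool
  ηb η v = if internal v then η v else false

Vec2 : Set
Vec2 = ℤ × ℤ

infixl 6 _-v_

_-v_ : Vec2 → Vec2 → Vec2
(a , b) -v (c , d) = (a - c , b - d)

det : Vec2 → Vec2 → ℤ
det (a , b) (c , d) = a * d - b * c

sgn : ℤ → ℤ
sgn (+ zero)   = + 0
sgn (+ suc _)  = + 1
sgn -[1+ _ ]   = - (+ 1)

s : Vec2 → Vec2 → ℤ
s f g = sgn (det f g)

infix 4 _==ℤ_ _<ℤ_

_==ℤ_ : ℤ → ℤ → Bool
a ==ℤ b = (a ℤ.≤ᵇ b) ∧ (b ℤ.≤ᵇ a)

_<ℤ_ : ℤ → ℤ → Bool
a <ℤ b = (a + + 1) ℤ.≤ᵇ b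

wind : Vec2 → Vec2 → Vec2 → ℤ
wind 𝔩 e f =
  if (s e f ==ℤ + 1) ∧ (s e 𝔩 ==ℤ + 1) ∧ (s 𝔩 f ==ℤ + 1) then + 1
  else if (s e f ==ℤ - + 1) ∧ (s e 𝔩 ==ℤ - + 1) ∧ (s 𝔩 f ==ℤ - + 1) then - + 1
  else + 0

-- does the ray {B + t𝔩 : t > 0} meet the open segment (P,Q)?
-- (with d = Q - P, D = det(𝔩,d), w = P - B, the meeting point has
--  ray parameter t = det(w,d)/D and segment parameter u = det(w,𝔩)/D)
rayMeets : Vec2 → Vec2 → Vec2 → Vec2 → Bool
rayMeets 𝔩 B P Q =
  let d = Q -v P ; D = det 𝔩 d ; w = P -v B in
  (+ 0 <ℤ (det w d * D)) ∧ (+ 0 <ℤ (det w 𝔩 * D)) ∧ ((det w 𝔩 * D) <ℤ (D * D))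

-- Boundary
-- vertices lie on the horizontal line y = 0, the disc is the region
-- above it.  Row i lies on the line y = n - i; column j of the diagram
-- is around x = -2j (larger j further west); in box B_ij the black
-- vertex V'_ij is at (-2j, n-i) and the white vertex V_ij at
-- (-2j-1, n-i), to its left.

pos : ∀ {n} → Vtx n → Vec2
pos (bnd a)   = (- (+ (2 ℕ.* toℕ a)) , + 0)
pos {n} (vI a)    = (- (+ (2 ℕ.* toℕ a)) , + (n ℕ.∸ toℕ a))
pos {n} (wht a b) = (- (+ (suc (2 ℕ.* toℕ b)))  , + (n ℕ.∸ toℕ a))
pos {n} (blk a b) = (- (+ (2 ℕ.* toℕ b)) , + (n ℕ.∸ toℕ a))

dir : ∀ {n} → Edge n → Vec2
dir e = pos (hd e) -v pos (tl e)

module _ {n : ℕ} (I : Fin n → Bool) (G : List (Edge n)) (𝔩 : Vec2) where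

  record IsGaugeDir : Set where
    field
      -- rays from the boundary vertices (on y = 0) enter the disc (y > 0)
      entersDisc : ℤ._<_ (+ 0) (proj₂ 𝔩)
      noParallel : All (λ e → det 𝔩 (dir e) ≢ + 0) G
      -- no ray from a boundary vertex passes through an internal vertex
      -- (since 𝔩 and all internal vertices lie strictly above y = 0,
      --  this is non-collinearity of v - b_s with 𝔩)
      noHit : (a : Fin n) → All (λ e →
                (internal (tl e) ≡ true → det (pos (tl e) -v pos (bnd a)) 𝔩 ≢ + 0) ×
                (internal (hd e) ≡ true → det (pos (hd e) -v pos (bnd a)) 𝔩 ≢ + 0)) G

  intE : Edge n → ℤ
  intE e = + card (λ a → I a ∧ rayMeets 𝔩 (pos (bnd a)) (pos (tl e)) (pos (hd e)))
           * s 𝔩 (dir e)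

  -- the (unique, by perfectness) incoming edge at U / outgoing edge at V
  incoming : Vtx n → Maybe (Edge n)
  incoming U = head (filterᵇ (λ e → hd e ==V U) G)

  outgoing : Vtx n → Maybe (Edge n)
  outgoing V = head (filterᵇ (λ e → tl e ==V V) G)

  windIn : Edge n → ℤ
  windIn e with incoming (tl e)
  ... | just e₁ = wind 𝔩 (dir e₁) (dir e)
  ... | nothing = + 0

  windOut : Edge n → ℤ
  windOut e with outgoing (hd e)
  ... | just e₅ = wind 𝔩 (dir e) (dir e₅)
  ... | nothing = + 0

  geoValue : Colour → Colour → Edge n → ℤ
  geoValue black    boundary e = intE e
  geoValue white    boundary e = + 1 + intE e + windIn e
  geoValue boundary black    e = + 1 + intE e + windOut e
  geoValue boundary white    e = + 1 + intE e
  geoValue black    white    e = intE e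
  geoValue white    white    e = + 1 + intE e + windIn e
  geoValue white    black    e = + 1 + intE e + windIn e + windOut e
  geoValue black    black    e = intE e + windOut e
  geoValue boundary boundary e = + 0

  geoSig : Edge n → Bool
  geoSig e = odd ∣ geoValue (colour (tl e)) (colour (hd e)) e ∣

module Submission where

-- Take the gauge direction 𝔩 = (2n+1, 1).  In the embedding of Defs every
-- vertex v sits at (-west v, north v) with 0 ≤ west v < 2n+1, so
-- det (v - w, 𝔩) = level w - level v for level v = west v + (2n+1) north v.
-- A boundary vertex b_a has level 2a < 2n+1, while every internal vertex has
-- level ≥ 2n+1: the rays from the sources pass below all internal vertices.
-- Hence they cross no internal edge, the ray from b_a crosses the source edge
-- (b_i, V_i) iff i < a, and it crosses the sink edge (V_ij, b_j) iff j < a.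
-- All winding numbers vanish, since consecutive edges never turn towards 𝔩.
-- So, writing c_i for the parity of #(I ∩ (i, n]), the geometric signature is
-- 1 + c_i on (b_i, V_i), 1 + c_j on (V_ij, b_j), 1 on V → V' and 0 on V' → V.
-- The gauge η(V_i) = η(V_ij) = 1 + c_i, η(V'_ij) = c_i turns the master
-- signature into it, since c_i = c_l + #(I ∩ (i, l]) for i < l.

open import Defs
open import Data.Bool using (Bool; true; false; _∧_; not; if_then_else_; _xor_; T; T?)
open import Data.Bool.Properties
  using (T-≡; ¬-not; T-∧; ∧-zeroʳ; not-involutive; ∧-assoc; not-distribˡ-xor; xor-same; xor-identityʳ)
open import Data.Empty using (⊥-elim)
open import Data.Fin using (Fin; toℕ)
open import Data.Fin.Properties using (toℕ<n; toℕ-injective)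
open import Data.Integer as ℤ using (ℤ; +_; -[1+_]; -_; _+_; _-_; _*_; _≤_; _<_; +≤+; +<+; -<+; 0ℤ; ∣_∣)
import Data.Integer.Properties as ℤP
open import Data.Integer.Tactic.RingSolver using (solve-∀)
open import Data.List using (List; []; _∷_; filterᵇ; allFin; length; head; last; cartesianProduct)
open import Data.List.Properties using (filter-≐; filter-none)
open import Data.List.Relation.Unary.All as All using (All; []; _∷_; universal)
open import Data.List.Relation.Unary.All.Properties
  using (all-filter; filter⁺; head⁺; last⁺; ++⁺; concat⁺; map⁺)
import Data.Maybe.Relation.Unary.All as Maybe
open import Data.Maybe using (just; nothing)
open import Data.Nat as ℕ using (ℕ; zero; suc; _∸_)
import Data.Nat.Properties as ℕP
open import Data.Product using (Σ; _×_; _,_; proj₁; proj₂)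
open import Data.Sum using (_⊎_; inj₁; inj₂)
open import Function using (_∘_)
open import Function.Bundles using (Equivalence)
open import Relation.Binary.PropositionalEquality
open import Relation.Nullary using (yes; no)
open import Relation.Nullary.Reflects using (Reflects; ofʸ; ofⁿ)

<F-reflects : ∀ {n} (a b : Fin n) → Reflects (toℕ a ℕ.< toℕ b) (a <F b)
<F-reflects a b = ℕP.<ᵇ-reflects-< (toℕ a) (toℕ b)

≤F-reflects : ∀ {n} (a b : Fin n) → Reflects (toℕ a ℕ.≤ toℕ b) (a ≤F b)
≤F-reflects a b = ℕP.≤ᵇ-reflects-≤ (toℕ a) (toℕ b)

<F⇒< : ∀ {n} {a b : Fin n} → T (a <F b) → toℕ a ℕ.< toℕ b
<F⇒< {a = a} {b} = ℕP.<ᵇ⇒< (toℕ a) (toℕ b)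

<⇒<F : ∀ {n} {a b : Fin n} → toℕ a ℕ.< toℕ b → (a <F b) ≡ true
<⇒<F = Equivalence.to T-≡ ∘ ℕP.<⇒<ᵇ

not-≤F : ∀ {n} (a b : Fin n) → not (a ≤F b) ≡ (b <F a)
not-≤F a b with a ≤F b | ≤F-reflects a b | b <F a | <F-reflects b a
... | true  | ofʸ a≤b | true  | ofʸ b<a = ⊥-elim (ℕP.<⇒≱ b<a a≤b)
... | true  | _       | false | _       = refl
... | false | _       | true  | _       = refl
... | false | ofⁿ a≰b | false | ofⁿ b≮a = ⊥-elim (a≰b (ℕP.≮⇒≥ b≮a))

length-filterᵇ-split : ∀ {A : Set} (p q : A → Bool) xs →
  length (filterᵇ p xs) ≡
    length (filterᵇ (λ x → p x ∧ q x) xs) ℕ.+ length (filterᵇ (λ x → p x ∧ not (q x)) xs)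
length-filterᵇ-split p q [] = refl
length-filterᵇ-split p q (x ∷ xs) with p x | q x
... | true  | true  = cong suc (length-filterᵇ-split p q xs)
... | true  | false = trans (cong suc (length-filterᵇ-split p q xs)) (sym (ℕP.+-suc _ _))
... | false | _     = length-filterᵇ-split p q xs

card-split : ∀ {n} (P Q : Fin n → Bool) →
  card P ≡ card (λ a → P a ∧ Q a) ℕ.+ card (λ a → P a ∧ not (Q a))
card-split {n} P Q = length-filterᵇ-split P Q (allFin n)

card-cong : ∀ {n} {P Q : Fin n → Bool} → (∀ a → P a ≡ Q a) → card P ≡ card Q
card-cong {n} {P} {Q} P≗Q =
  cong length (filter-≐ (T? ∘ P) (T? ∘ Q) (P⊆Q , Q⊆P) (allFin n))
  where
  P⊆Q : ∀ {a} → T (P a) → T (Q a)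
  P⊆Q {a} = subst T (P≗Q a)
  Q⊆P : ∀ {a} → T (Q a) → T (P a)
  Q⊆P {a} = subst T (sym (P≗Q a))

card-none : ∀ {n} {P : Fin n → Bool} → (∀ a → P a ≡ false) → card P ≡ 0
card-none {n} {P} P≗false =
  cong length (filter-none (T? ∘ P) (universal (λ a → subst T (P≗false a)) (allFin n)))

odd-+ : ∀ x y → odd (x ℕ.+ y) ≡ odd x xor odd y
odd-+ zero    y = refl
odd-+ (suc x) y = trans (cong not (odd-+ x y)) (not-distribˡ-xor (odd x) (odd y))

odd∣1-c∣ : ∀ c → odd ∣ + 1 - + c ∣ ≡ not (odd c)
odd∣1-c∣ zero          = refl
odd∣1-c∣ (suc zero)    = refl
odd∣1-c∣ (suc (suc c)) = sym (not-involutive (odd (suc c)))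

i<j⇒i-j<0 : ∀ {i j} → i < j → i - j < 0ℤ
i<j⇒i-j<0 {i} {j} i<j = subst (i - j <_) (ℤP.+-inverseʳ j) (ℤP.+-monoˡ-< (- j) i<j)

j<i⇒0<i-j : ∀ {i j} → j < i → 0ℤ < i - j
j<i⇒0<i-j {i} {j} j<i = subst (_< i - j) (ℤP.+-inverseʳ j) (ℤP.+-monoˡ-< (- j) j<i)

pos*pos : ∀ {x y} → 0ℤ < x → 0ℤ < y → 0ℤ < x * y
pos*pos {+ suc _} {+ suc _} _         _         = +<+ (ℕ.s≤s ℕ.z≤n)
pos*pos {+ zero}            (+<+ ()) _
pos*pos {+ suc _} {+ zero}  _         (+<+ ())

neg*neg : ∀ {x y} → x < 0ℤ → y < 0ℤ → 0ℤ < x * y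
neg*neg { -[1+ _ ]} { -[1+ _ ]} _        _        = +<+ (ℕ.s≤s ℕ.z≤n)
neg*neg {+ _}                   (+<+ ()) _
neg*neg { -[1+ _ ]} {+ _}       _        (+<+ ())

neg*pos : ∀ {x y} → x < 0ℤ → 0ℤ < y → x * y < 0ℤ
neg*pos { -[1+ _ ]} {+ suc _} _        _        = -<+
neg*pos {+ _}                 (+<+ ()) _
neg*pos { -[1+ _ ]} {+ zero}  _        (+<+ ())

pos*neg : ∀ {x y} → 0ℤ < x → y < 0ℤ → x * y < 0ℤ
pos*neg {+ suc _} { -[1+ _ ]} _        _        = -<+
pos*neg {+ zero}              (+<+ ()) _
pos*neg {+ suc _} {+ _}       _        (+<+ ())

sgn-pos : ∀ {z} → 0ℤ < z → sgn z ≡ + 1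
sgn-pos {+ suc _} _ = refl
sgn-pos {+ zero} (+<+ ())

sgn-neg : ∀ {z} → z < 0ℤ → sgn z ≡ - + 1
sgn-neg { -[1+ _ ]} _ = refl
sgn-neg {+ _} (+<+ ())

<ℤ-true : ∀ {x y} → x < y → (x <ℤ y) ≡ true
<ℤ-true {x} {y} x<y =
  Equivalence.to T-≡ (ℤP.≤⇒≤ᵇ (subst (_≤ y) (ℤP.+-comm (+ 1) x) (ℤP.i<j⇒suc[i]≤j x<y)))

<ℤ-false : ∀ {x y} → y ≤ x → (x <ℤ y) ≡ false
<ℤ-false {x} {y} y≤x = ¬-not λ x<ᵇy → ℤP.<-irrefl refl (ℤP.<-≤-trans
  (ℤP.suc[i]≤j⇒i<j (subst (_≤ y) (ℤP.+-comm x (+ 1)) (ℤP.≤ᵇ⇒≤ (Equivalence.from T-≡ x<ᵇy)))) y≤x)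

-- The denominator of rayMeets is the difference of the sides of P and Q.
det-𝔩-sides : ∀ 𝔩 B P Q → det 𝔩 (Q -v P) ≡ det (P -v B) 𝔩 - det (Q -v B) 𝔩
det-𝔩-sides (lx , ly) (bx , by) (px , py) (qx , qy) = lemma lx ly bx by px py qx qy
  where
  lemma : ∀ lx ly bx by px py qx qy → lx * (qy - py) - ly * (qx - px) ≡
    ((px - bx) * ly - (py - by) * lx) - ((qx - bx) * ly - (qy - by) * lx)
  lemma = solve-∀

module _ (𝔩 B P Q : Vec2) where
  private
    τ = det (P -v B) (Q -v P)
    α = det (P -v B) 𝔩
    β = det (Q -v B) 𝔩
    D = det 𝔩 (Q -v P)

  rayMeets-sameSide : det (P -v B) 𝔩 ≤ 0ℤ → det (Q -v B) 𝔩 ≤ 0ℤ → rayMeets 𝔩 B P Q ≡ false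
  -- D = α - β: if D > 0 then α D ≤ 0, and otherwise α ≤ D ≤ 0 gives D D ≤ α D.
  rayMeets-sameSide α≤0 β≤0 with 0ℤ ℤP.<? D
  ... | yes 0<D = second-false (+ 0 <ℤ τ * D) (α * D <ℤ D * D) (<ℤ-false αD≤0)
    where
    second-false : ∀ a {b} c → b ≡ false → (a ∧ b ∧ c) ≡ false
    second-false a c refl = ∧-zeroʳ a
    αD≤0 : α * D ≤ 0ℤ
    αD≤0 = subst (α * D ≤_) (ℤP.*-zeroˡ D)
                 (ℤP.*-monoʳ-≤-nonNeg D {{ℤ.nonNegative (ℤP.<⇒≤ 0<D)}} α≤0)
  ... | no 0≮D = third-false (+ 0 <ℤ τ * D) (+ 0 <ℤ α * D) (<ℤ-false DD≤αD)
    where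
    third-false : ∀ a b {c} → c ≡ false → (a ∧ b ∧ c) ≡ false
    third-false a b refl = trans (cong (a ∧_) (∧-zeroʳ b)) (∧-zeroʳ a)
    α≤D : α ≤ D
    α≤D = subst₂ _≤_ (ℤP.+-identityʳ α) (sym (det-𝔩-sides 𝔩 B P Q))
                     (ℤP.+-monoʳ-≤ α (ℤP.neg-mono-≤ β≤0))
    DD≤αD : D * D ≤ α * D
    DD≤αD = ℤP.*-monoʳ-≤-nonPos D {{ℤ.nonPositive (ℤP.≮⇒≥ 0≮D)}} α≤D

  rayMeets-crossing : 0ℤ < det (P -v B) (Q -v P) * det 𝔩 (Q -v P) →
    0ℤ < det (P -v B) 𝔩 * det 𝔩 (Q -v P) → det (Q -v B) 𝔩 * det 𝔩 (Q -v P) < 0ℤ →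
    rayMeets 𝔩 B P Q ≡ true
  rayMeets-crossing 0<τD 0<αD βD<0 = all-true (<ℤ-true 0<τD) (<ℤ-true 0<αD) (<ℤ-true αD<DD)
    where
    all-true : ∀ {a b c} → a ≡ true → b ≡ true → c ≡ true → (a ∧ b ∧ c) ≡ true
    all-true refl refl refl = refl
    *-distribʳ-- : ∀ a b d → (a - b) * d ≡ a * d - b * d
    *-distribʳ-- = solve-∀
    DD≡αD-βD : D * D ≡ α * D - β * D
    DD≡αD-βD = trans (cong (_* D) (det-𝔩-sides 𝔩 B P Q)) (*-distribʳ-- α β D)
    αD<DD : α * D < D * D
    αD<DD = subst₂ _<_ (ℤP.+-identityʳ (α * D)) (sym DD≡αD-βD) (ℤP.+-monoʳ-< (α * D) (ℤP.neg-mono-< βD<0))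

-- wind 𝔩 e f unfolds to windOfSigns (s e f) (s e 𝔩) (s 𝔩 f).
private
  windOfSigns : ℤ → ℤ → ℤ → ℤ
  windOfSigns σ τ ρ =
    if (σ ==ℤ + 1) ∧ (τ ==ℤ + 1) ∧ (ρ ==ℤ + 1) then + 1
    else if (σ ==ℤ - + 1) ∧ (τ ==ℤ - + 1) ∧ (ρ ==ℤ - + 1) then - + 1
    else + 0

wind≡0-leftTurn : ∀ 𝔩 e f → 0ℤ ≤ det e f → det e 𝔩 < 0ℤ → wind 𝔩 e f ≡ + 0
wind≡0-leftTurn 𝔩 e f = lemma (det e f) (det e 𝔩) (s 𝔩 f)
  where
  lemma : ∀ x y ρ → 0ℤ ≤ x → y < 0ℤ → windOfSigns (sgn x) (sgn y) ρ ≡ + 0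
  lemma (+ zero)  -[1+ _ ] ρ _ _ = refl
  lemma (+ suc _) -[1+ _ ] ρ _ _ = refl
  lemma (+ _)     (+ _)    ρ _ (+<+ ())

wind≡0-rightTurn : ∀ 𝔩 e f → det e f ≤ 0ℤ → 0ℤ < det e 𝔩 → wind 𝔩 e f ≡ + 0
wind≡0-rightTurn 𝔩 e f = lemma (det e f) (det e 𝔩) (s 𝔩 f)
  where
  lemma : ∀ x y ρ → x ≤ 0ℤ → 0ℤ < y → windOfSigns (sgn x) (sgn y) ρ ≡ + 0
  lemma (+ zero)  (+ suc _) ρ _        _ = refl
  lemma -[1+ _ ]  (+ suc _) ρ _        _ = refl
  lemma (+ suc _) _         ρ (+≤+ ()) _
  lemma _         (+ zero)  ρ _        (+<+ ())

module _ {n : ℕ} (I : Fin n → Bool) (G : List (Edge n)) (𝔩 : Vec2) where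

  windIn-≡0 : ∀ e → (∀ e₁ → T (hd e₁ ==V tl e) → wind 𝔩 (dir e₁) (dir e) ≡ + 0) →
    windIn I G 𝔩 e ≡ + 0
  windIn-≡0 e wind≡0 with incoming I G 𝔩 (tl e) | head⁺ (all-filter (T? ∘ (λ e₁ → hd e₁ ==V tl e)) G)
  ... | just e₁ | Maybe.just e₁↦e = wind≡0 e₁ e₁↦e
  ... | nothing | _               = refl

  windOut-≡0 : ∀ {P : Edge n → Set} → All P G → ∀ e →
    (∀ e₅ → P e₅ → T (tl e₅ ==V hd e) → wind 𝔩 (dir e) (dir e₅) ≡ + 0) →
    windOut I G 𝔩 e ≡ + 0
  windOut-≡0 PG e wind≡0 with outgoing I G 𝔩 (hd e)
    | head⁺ (All.zip (filter⁺ (T? ∘ (λ e₅ → tl e₅ ==V hd e)) PG ,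
                      all-filter (T? ∘ (λ e₅ → tl e₅ ==V hd e)) G))
  ... | just e₅ | Maybe.just (Pe₅ , e↦e₅) = wind≡0 e₅ Pe₅ e↦e₅
  ... | nothing | _                       = refl

module _ {n : ℕ} (I : Fin n → Bool) where

  data Shape : Edge n → Set where
    src  : ∀ i → Shape (src i)
    bw   : ∀ i j → Shape (bw i j)
    horV : ∀ {i j} → toℕ i ℕ.< toℕ j → Shape (hor (vI i) i j)
    horW : ∀ {i l j} → toℕ l ℕ.< toℕ j → Shape (hor (wht i l) i j)
    ver  : ∀ {i l j} → toℕ i ℕ.< toℕ l → Shape (ver i l j)
    snk  : ∀ {i j} → toℕ i ℕ.< toℕ j → I j ≡ false → Shape (snk i j)

  module _ (L : Fin n → Fin n → Bool) where

    filled⇒< : ∀ {i j} → filled I L i j ≡ true → toℕ i ℕ.< toℕ j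
    filled⇒< {i} {j} filled-ij with I i | I j
    ... | true | false = <F⇒< (proj₁ (Equivalence.to T-∧ (Equivalence.from T-≡ filled-ij)))

    filled⇒∉I : ∀ {i j} → filled I L i j ≡ true → I j ≡ false
    filled⇒∉I {i} {j} filled-ij with I i | I j
    ... | true | false = refl

    rightWhite-shape : ∀ {i j} → filled I L i j ≡ true → Shape (hor (rightWhite I L i j) i j)
    rightWhite-shape {i} {j} filled-ij
      with last (filterᵇ (λ l → filled I L i l ∧ (l <F j)) (allFin n))
         | last⁺ (all-filter (T? ∘ (λ l → filled I L i l ∧ (l <F j))) (allFin n))
    ... | just l  | Maybe.just l-ok = horW (<F⇒< (proj₂ (Equivalence.to T-∧ l-ok)))
    ... | nothing | _               = horV (filled⇒< filled-ij)

    downEdge-shape : ∀ {i j} → filled I L i j ≡ true → Shape (downEdge I L i j)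
    downEdge-shape {i} {j} filled-ij
      with head (filterᵇ (λ l → (i <F l) ∧ filled I L l j) (allFin n))
         | head⁺ (all-filter (T? ∘ (λ l → (i <F l) ∧ filled I L l j)) (allFin n))
    ... | just l  | Maybe.just l-ok = ver (<F⇒< (proj₁ (Equivalence.to T-∧ l-ok)))
    ... | nothing | _               = snk (filled⇒< filled-ij) (filled⇒∉I filled-ij)

    leEdges-shape : All Shape (leEdges I L)
    leEdges-shape = ++⁺ (concat⁺ (map⁺ (universal srcEdges-shape (allFin n))))
                        (concat⁺ (map⁺ (universal boxEdges-shape (cartesianProduct (allFin n) (allFin n)))))
      where
      srcEdges-shape : ∀ i → All Shape (srcEdges I L i)
      srcEdges-shape i with I i
      ... | true  = src i ∷ []
      ... | false = []
      boxEdges-shape : ∀ p → All Shape (boxEdges I L p)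
      boxEdges-shape (i , j) with filled I L i j in filled-ij
      ... | true  = bw i j ∷ rightWhite-shape filled-ij ∷ downEdge-shape filled-ij ∷ []
      ... | false = []

gaugeDir : ℕ → Vec2
gaugeDir n = (+ suc (2 ℕ.* n) , + 1)

module Embedding (n : ℕ) where

  m : ℕ
  m = suc (2 ℕ.* n)

  𝔩 : Vec2
  𝔩 = gaugeDir n

  west : Vtx n → ℕ
  west (bnd a)   = 2 ℕ.* toℕ a
  west (vI a)    = 2 ℕ.* toℕ a
  west (wht _ b) = suc (2 ℕ.* toℕ b)
  west (blk _ b) = 2 ℕ.* toℕ b

  north : Vtx n → ℕ
  north (bnd _)   = 0
  north (vI a)    = n ∸ toℕ a
  north (wht a _) = n ∸ toℕ a
  north (blk a _) = n ∸ toℕ a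

  pos-west-north : ∀ v → pos v ≡ (- + west v , + north v)
  pos-west-north (bnd _)   = refl
  pos-west-north (vI _)    = refl
  pos-west-north (wht _ _) = refl
  pos-west-north (blk _ _) = refl

  level : Vtx n → ℕ
  level v = west v ℕ.+ north v ℕ.* m

  +level : ∀ v → + level v ≡ + west v + + north v * + m
  +level v = trans (ℤP.pos-+ (west v) (north v ℕ.* m)) (cong (_+_ (+ west v)) (ℤP.pos-* (north v) m))

  det-level : ∀ v w → det (pos v -v pos w) 𝔩 ≡ + level w - + level v
  det-level v w rewrite pos-west-north v | pos-west-north w | +level v | +level w =
    lemma (+ west v) (+ north v) (+ west w) (+ north w) (+ m)
    where
    lemma : ∀ xv yv xw yw M → (- xv - - xw) * + 1 - (yv - yw) * M ≡ (xw + yw * M) - (xv + yv * M)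
    lemma = solve-∀

  det-𝔩-level : ∀ v w → det 𝔩 (pos v -v pos w) ≡ + level v - + level w
  det-𝔩-level v w rewrite pos-west-north v | pos-west-north w | +level v | +level w =
    lemma (+ west v) (+ north v) (+ west w) (+ north w) (+ m)
    where
    lemma : ∀ xv yv xw yw M → M * (yv - yw) - + 1 * (- xv - - xw) ≡ (xv + yv * M) - (xw + yw * M)
    lemma = solve-∀

  det-level<0 : ∀ v w → level w ℕ.< level v → det (pos v -v pos w) 𝔩 < 0ℤ
  det-level<0 v w w<v = subst (_< 0ℤ) (sym (det-level v w)) (i<j⇒i-j<0 (+<+ w<v))

  det-level>0 : ∀ v w → level v ℕ.< level w → 0ℤ < det (pos v -v pos w) 𝔩
  det-level>0 v w v<w = subst (0ℤ <_) (sym (det-level v w)) (j<i⇒0<i-j (+<+ v<w))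

  det-level≤0 : ∀ v w → level w ℕ.≤ level v → det (pos v -v pos w) 𝔩 ≤ 0ℤ
  det-level≤0 v w w≤v = subst (_≤ 0ℤ) (sym (det-level v w)) (ℤP.i≤j⇒i-j≤0 (+≤+ w≤v))

  det-𝔩-level>0 : ∀ v w → level w ℕ.< level v → 0ℤ < det 𝔩 (pos v -v pos w)
  det-𝔩-level>0 v w w<v = subst (0ℤ <_) (sym (det-𝔩-level v w)) (j<i⇒0<i-j (+<+ w<v))

  det-𝔩-level<0 : ∀ v w → level v ℕ.< level w → det 𝔩 (pos v -v pos w) < 0ℤ
  det-𝔩-level<0 v w v<w = subst (_< 0ℤ) (sym (det-𝔩-level v w)) (i<j⇒i-j<0 (+<+ v<w))

  north-pos : ∀ v → internal v ≡ true → 1 ℕ.≤ north v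
  north-pos (vI a)    _ = ℕP.m<n⇒0<n∸m (toℕ<n a)
  north-pos (wht a _) _ = ℕP.m<n⇒0<n∸m (toℕ<n a)
  north-pos (blk a _) _ = ℕP.m<n⇒0<n∸m (toℕ<n a)

  level-bnd<m : ∀ a → level (bnd a) ℕ.< m
  level-bnd<m a =
    ℕ.s≤s (subst (ℕ._≤ 2 ℕ.* n) (sym (ℕP.+-identityʳ _)) (ℕP.*-monoʳ-≤ 2 (ℕP.<⇒≤ (toℕ<n a))))

  m≤level : ∀ v → internal v ≡ true → m ℕ.≤ level v
  m≤level v v-int = ℕP.≤-trans
    (subst (ℕ._≤ north v ℕ.* m) (ℕP.*-identityˡ m) (ℕP.*-monoˡ-≤ m (north-pos v v-int)))
    (ℕP.m≤n+m _ (west v))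

  bnd-below : ∀ a v → internal v ≡ true → level (bnd a) ℕ.< level v
  bnd-below a v v-int = ℕP.<-≤-trans (level-bnd<m a) (m≤level v v-int)

  level-bnd-mono-< : ∀ {a b} → toℕ a ℕ.< toℕ b → level (bnd a) ℕ.< level (bnd b)
  level-bnd-mono-< a<b = ℕP.+-monoˡ-< 0 (ℕP.*-monoʳ-< 2 a<b)

  level-bnd-mono-≤ : ∀ {a b} → toℕ a ℕ.≤ toℕ b → level (bnd a) ℕ.≤ level (bnd b)
  level-bnd-mono-≤ a≤b = ℕP.+-monoˡ-≤ 0 (ℕP.*-monoʳ-≤ 2 a≤b)

  Ascends Descends : Edge n → Set
  Ascends e = level (tl e) ℕ.< level (hd e)
  Descends e = level (hd e) ℕ.< level (tl e)

  src-ascends : ∀ i → Ascends (src i)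
  src-ascends i = bnd-below i (vI i) refl

  bw-ascends : ∀ i j → Ascends (bw i j)
  bw-ascends i j = ℕP.n<1+n _

  horV-ascends : ∀ {i j} → toℕ i ℕ.< toℕ j → Ascends (hor (vI i) i j)
  horV-ascends i<j = ℕP.+-monoˡ-< _ (ℕP.*-monoʳ-< 2 i<j)

  horW-ascends : ∀ {i l j} → toℕ l ℕ.< toℕ j → Ascends (hor (wht i l) i j)
  horW-ascends {l = l} {j} l<j =
    ℕP.+-monoˡ-< _ (subst (ℕ._≤ 2 ℕ.* toℕ j) (ℕP.*-suc 2 (toℕ l)) (ℕP.*-monoʳ-≤ 2 l<j))

  ver-descends : ∀ {i l j} → toℕ i ℕ.< toℕ l → Descends (ver i l j)
  ver-descends {i} {l} {j} i<l =
    ℕ.s≤s (ℕP.+-monoʳ-≤ (2 ℕ.* toℕ j) (ℕP.*-monoˡ-≤ m (ℕP.∸-monoʳ-≤ n (ℕP.<⇒≤ i<l))))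

  snk-descends : ∀ i j → Descends (snk i j)
  snk-descends i j = bnd-below j (wht i j) refl

  shape-slope : ∀ {I e} → Shape I e → Ascends e ⊎ Descends e
  shape-slope (src i)                = inj₁ (src-ascends i)
  shape-slope (bw i j)               = inj₁ (bw-ascends i j)
  shape-slope (horV {i} {j} i<j)     = inj₁ (horV-ascends {i} {j} i<j)
  shape-slope (horW {i} {l} {j} l<j) = inj₁ (horW-ascends {i} {l} {j} l<j)
  shape-slope (ver {i} {l} {j} i<l)  = inj₂ (ver-descends {i} {l} {j} i<l)
  shape-slope (snk {i} {j} _ _)      = inj₂ (snk-descends i j)

sourcesAfter : ∀ {n} → (Fin n → Bool) → Fin n → ℕ
sourcesAfter I i = card (λ a → I a ∧ (i <F a))

module _ {n : ℕ} (I : Fin n → Bool) where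
  open Embedding n

  rayMeets-above : ∀ a v w → level (bnd a) ℕ.≤ level v → level (bnd a) ℕ.≤ level w →
    rayMeets 𝔩 (pos (bnd a)) (pos v) (pos w) ≡ false
  rayMeets-above a v w a≤v a≤w =
    rayMeets-sameSide 𝔩 (pos (bnd a)) (pos v) (pos w) (det-level≤0 v (bnd a) a≤v) (det-level≤0 w (bnd a) a≤w)

  rayMeets-src : ∀ i a → rayMeets 𝔩 (pos (bnd a)) (pos (bnd i)) (pos (vI i)) ≡ (i <F a)
  rayMeets-src i a with i <F a | <F-reflects i a
  ... | false | ofⁿ i≮a =
    rayMeets-above a (bnd i) (vI i) (level-bnd-mono-≤ (ℕP.≮⇒≥ i≮a)) (ℕP.<⇒≤ (bnd-below a (vI i) refl))
  ... | true  | ofʸ i<a = rayMeets-crossing 𝔩 (pos (bnd a)) (pos (bnd i)) (pos (vI i))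
    (pos*pos 0<τ 0<D) (pos*pos 0<α 0<D) (neg*pos β<0 0<D)
    where
    0<D = det-𝔩-level>0 (vI i) (bnd i) (src-ascends i)
    0<α = det-level>0 (bnd i) (bnd a) (level-bnd-mono-< i<a)
    β<0 = det-level<0 (vI i) (bnd a) (bnd-below a (vI i) refl)
    τ-up : ∀ xa xi y → (- xi - - xa) * (y - + 0) - (+ 0 - + 0) * (- xi - - xi) ≡ (xa - xi) * y
    τ-up = solve-∀
    0<τ : 0ℤ < det (pos (bnd i) -v pos (bnd a)) (pos (vI i) -v pos (bnd i))
    0<τ = subst (0ℤ <_) (sym (τ-up (+ (2 ℕ.* toℕ a)) (+ (2 ℕ.* toℕ i)) (+ (n ∸ toℕ i))))
      (pos*pos (j<i⇒0<i-j (+<+ (ℕP.*-monoʳ-< 2 i<a))) (+<+ (north-pos (vI i) refl)))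

  rayMeets-snk : ∀ i j a → rayMeets 𝔩 (pos (bnd a)) (pos (wht i j)) (pos (bnd j)) ≡ (j <F a)
  rayMeets-snk i j a with j <F a | <F-reflects j a
  ... | false | ofⁿ j≮a =
    rayMeets-above a (wht i j) (bnd j) (ℕP.<⇒≤ (bnd-below a (wht i j) refl)) (level-bnd-mono-≤ (ℕP.≮⇒≥ j≮a))
  ... | true  | ofʸ j<a = rayMeets-crossing 𝔩 (pos (bnd a)) (pos (wht i j)) (pos (bnd j))
    (neg*neg τ<0 D<0) (neg*neg α<0 D<0) (pos*neg 0<β D<0)
    where
    D<0 = det-𝔩-level<0 (bnd j) (wht i j) (snk-descends i j)
    α<0 = det-level<0 (wht i j) (bnd a) (bnd-below a (wht i j) refl)
    0<β = det-level>0 (bnd j) (bnd a) (level-bnd-mono-< j<a)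
    τ-down : ∀ xa xj y → (- (+ 1 + xj) - - xa) * (+ 0 - y) - (y - + 0) * (- xj - - (+ 1 + xj)) ≡ - ((xa - xj) * y)
    τ-down = solve-∀
    τ<0 : det (pos (wht i j) -v pos (bnd a)) (pos (bnd j) -v pos (wht i j)) < 0ℤ
    τ<0 = subst (_< 0ℤ) (sym (τ-down (+ (2 ℕ.* toℕ a)) (+ (2 ℕ.* toℕ j)) (+ (n ∸ toℕ i))))
      (ℤP.neg-mono-< (pos*pos (j<i⇒0<i-j (+<+ (ℕP.*-monoʳ-< 2 j<a))) (+<+ (north-pos (wht i j) refl))))

  module _ (G : List (Edge n)) where

    intE-internal : ∀ e → internal (tl e) ≡ true → internal (hd e) ≡ true → intE I G 𝔩 e ≡ + 0
    intE-internal e tl-int hd-int = cong (λ c → + c * s 𝔩 (dir e)) (card-none λ a →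
      trans (cong (I a ∧_) (rayMeets-above a (tl e) (hd e)
                              (ℕP.<⇒≤ (bnd-below a (tl e) tl-int)) (ℕP.<⇒≤ (bnd-below a (hd e) hd-int))))
            (∧-zeroʳ (I a)))

    intE-src : ∀ i → intE I G 𝔩 (src i) ≡ + sourcesAfter I i
    intE-src i = trans
      (cong₂ (λ c σ → + c * σ) (card-cong λ a → cong (I a ∧_) (rayMeets-src i a))
                               (sgn-pos (det-𝔩-level>0 (vI i) (bnd i) (src-ascends i))))
      (ℤP.*-identityʳ _)

    intE-snk : ∀ i j → intE I G 𝔩 (snk i j) ≡ - + sourcesAfter I j
    intE-snk i j = trans
      (cong₂ (λ c σ → + c * σ) (card-cong λ a → cong (I a ∧_) (rayMeets-snk i j a))
                               (sgn-neg (det-𝔩-level<0 (bnd j) (wht i j) (snk-descends i j))))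
      (*-neg1 _)
      where
      *-neg1 : ∀ x → x * - + 1 ≡ - x
      *-neg1 = solve-∀

module _ {n : ℕ} where
  open Embedding n

  det-bw-left : ∀ p q f → det (dir (bw p q)) f ≡ - proj₂ f
  det-bw-left p q (fx , fy) = lemma (+ (2 ℕ.* toℕ q)) (+ (n ∸ toℕ p)) fx fy
    where
    lemma : ∀ k y fx fy → (- (+ 1 + k) - - k) * fy - (y - y) * fx ≡ - fy
    lemma = solve-∀

  det-bw-right : ∀ p q e → det e (dir (bw p q)) ≡ proj₂ e
  det-bw-right p q (ex , ey) = lemma (+ (2 ℕ.* toℕ q)) (+ (n ∸ toℕ p)) ex ey
    where
    lemma : ∀ k y ex ey → ex * (y - y) - ey * (- (+ 1 + k) - - k) ≡ ey
    lemma = solve-∀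

  wind-from-bw : ∀ p q f → proj₂ f ≤ 0ℤ → wind 𝔩 (dir (bw p q)) f ≡ + 0
  wind-from-bw p q f f↓ = wind≡0-leftTurn 𝔩 (dir (bw p q)) f
    (subst (0ℤ ≤_) (sym (det-bw-left p q f)) (ℤP.neg-mono-≤ f↓))
    (det-level<0 (wht p q) (blk p q) (bw-ascends p q))

  wind-ascending-to-bw : ∀ e p q → 0ℤ ≤ proj₂ (dir e) → Ascends e →
    wind 𝔩 (dir e) (dir (bw p q)) ≡ + 0
  wind-ascending-to-bw e p q e↑ e-asc = wind≡0-leftTurn 𝔩 (dir e) (dir (bw p q))
    (subst (0ℤ ≤_) (sym (det-bw-right p q (dir e))) e↑) (det-level<0 (hd e) (tl e) e-asc)

  wind-descending-to-bw : ∀ e p q → proj₂ (dir e) ≤ 0ℤ → Descends e →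
    wind 𝔩 (dir e) (dir (bw p q)) ≡ + 0
  wind-descending-to-bw e p q e↓ e-desc = wind≡0-rightTurn 𝔩 (dir e) (dir (bw p q))
    (subst (_≤ 0ℤ) (sym (det-bw-right p q (dir e))) e↓) (det-level>0 (hd e) (tl e) e-desc)

  wind-from-src-to-horV : ∀ i′ {i j} → toℕ i ℕ.< toℕ j →
    wind 𝔩 (dir (src i′)) (dir (hor (vI i) i j)) ≡ + 0
  wind-from-src-to-horV i′ {i} {j} i<j =
    wind≡0-leftTurn 𝔩 (dir (src i′)) (dir (hor (vI i) i j))
      left-turn (det-level<0 (vI i′) (bnd i′) (src-ascends i′))
    where
    lemma : ∀ x y a b z → (- x - - x) * (z - z) - (y - + 0) * (- b - - a) ≡ y * (b - a)
    lemma = solve-∀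
    left-turn : 0ℤ ≤ det (dir (src i′)) (dir (hor (vI i) i j))
    left-turn = subst (0ℤ ≤_)
      (sym (lemma (+ (2 ℕ.* toℕ i′)) (+ (n ∸ toℕ i′)) (+ (2 ℕ.* toℕ i)) (+ (2 ℕ.* toℕ j))
                  (+ (n ∸ toℕ i))))
      (ℤP.<⇒≤ (pos*pos (+<+ (north-pos (vI i′) refl)) (j<i⇒0<i-j (+<+ (ℕP.*-monoʳ-< 2 i<j)))))

sourcesAfter-split≤ : ∀ {n} (I : Fin n → Bool) {i l} → toℕ i ℕ.< toℕ l →
  sourcesAfter I i ≡ card (λ a → I a ∧ (i <F a) ∧ (a ≤F l)) ℕ.+ sourcesAfter I l
sourcesAfter-split≤ I {i} {l} i<l = trans (card-split (λ a → I a ∧ (i <F a)) (λ a → a ≤F l))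
  (cong₂ ℕ._+_ (card-cong λ a → ∧-assoc (I a) (i <F a) (a ≤F l)) (card-cong after-l))
  where
  after-l : ∀ a → (I a ∧ (i <F a)) ∧ not (a ≤F l) ≡ I a ∧ (l <F a)
  after-l a rewrite not-≤F a l with I a | l <F a | <F-reflects l a
  ... | false | _     | _       = refl
  ... | true  | false | _       = ∧-zeroʳ (i <F a)
  ... | true  | true  | ofʸ l<a rewrite <⇒<F {a = i} {a} (ℕP.<-trans i<l l<a) = refl

sourcesAfter-split< : ∀ {n} (I : Fin n → Bool) {i j} → toℕ i ℕ.< toℕ j → I j ≡ false →
  sourcesAfter I i ≡ card (λ a → I a ∧ (i <F a) ∧ (a <F j)) ℕ.+ sourcesAfter I j
sourcesAfter-split< I {i} {j} i<j j∉I =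
  trans (sourcesAfter-split≤ I i<j) (cong (ℕ._+ sourcesAfter I j) (card-cong below-j))
  where
  ≤F≡<F : ∀ a → I a ≡ true → (a ≤F j) ≡ (a <F j)
  ≤F≡<F a a∈I with a ≤F j | ≤F-reflects a j | a <F j | <F-reflects a j
  ... | true  | _       | true  | _       = refl
  ... | false | _       | false | _       = refl
  ... | false | ofⁿ a≰j | true  | ofʸ a<j = ⊥-elim (a≰j (ℕP.<⇒≤ a<j))
  ... | true  | ofʸ a≤j | false | ofⁿ a≮j
    with trans (sym a∈I) (trans (cong I (toℕ-injective (ℕP.≤-antisym a≤j (ℕP.≮⇒≥ a≮j)))) j∉I)
  ... | ()
  below-j : ∀ a → I a ∧ (i <F a) ∧ (a ≤F j) ≡ I a ∧ (i <F a) ∧ (a <F j)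
  below-j a with I a in a∈I
  ... | false = refl
  ... | true  = cong ((i <F a) ∧_) (≤F≡<F a a∈I)

sourceParity : ∀ {n} → (Fin n → Bool) → Fin n → Bool
sourceParity I i = odd (sourcesAfter I i)

sourceParity-split≤ : ∀ {n} (I : Fin n → Bool) {i l} → toℕ i ℕ.< toℕ l →
  sourceParity I i ≡ odd (card (λ a → I a ∧ (i <F a) ∧ (a ≤F l))) xor sourceParity I l
sourceParity-split≤ I {i} {l} i<l =
  trans (cong odd (sourcesAfter-split≤ I i<l))
        (odd-+ (card (λ a → I a ∧ (i <F a) ∧ (a ≤F l))) (sourcesAfter I l))

sourceParity-split< : ∀ {n} (I : Fin n → Bool) {i j} → toℕ i ℕ.< toℕ j → I j ≡ false →
  sourceParity I i ≡ odd (card (λ a → I a ∧ (i <F a) ∧ (a <F j))) xor sourceParity I j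
sourceParity-split< I {i} {j} i<j j∉I =
  trans (cong odd (sourcesAfter-split< I i<j j∉I))
        (odd-+ (card (λ a → I a ∧ (i <F a) ∧ (a <F j))) (sourcesAfter I j))

η : ∀ {n} → (Fin n → Bool) → Vtx n → Bool
η I (bnd _)   = false
η I (vI i)    = not (sourceParity I i)
η I (wht i _) = not (sourceParity I i)
η I (blk i _) = sourceParity I i

not-xor-self : ∀ x → not x xor x ≡ true
not-xor-self true  = refl
not-xor-self false = refl

xor-not-xor : ∀ x y → x xor not (x xor y) ≡ not y
xor-not-xor true  true  = refl
xor-not-xor true  false = refl
xor-not-xor false _     = refl

odd∣1+0+0+0∣ : ∀ {a b c} → a ≡ + 0 → b ≡ + 0 → c ≡ + 0 → odd ∣ + 1 + a + b + c ∣ ≡ true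
odd∣1+0+0+0∣ refl refl refl = refl

module _ {n : ℕ} (I : Fin n → Bool) (L : Fin n → Fin n → Bool) where
  open Embedding n
  open ≡-Reasoning

  private
    G = leEdges I L
    c = sourceParity I
    ηᵇ : Vtx n → Bool
    ηᵇ v = if internal v then η I v else false

  gaugeDir-isGaugeDir : IsGaugeDir I G 𝔩
  gaugeDir-isGaugeDir = record
    { entersDisc = +<+ (ℕ.s≤s ℕ.z≤n)
    ; noParallel = All.map not-parallel (leEdges-shape I L)
    ; noHit      = λ a → universal (λ e → off-ray a (tl e) , off-ray a (hd e)) G
    }
    where
    ≢0-pos : ∀ {z} → 0ℤ < z → z ≢ 0ℤ
    ≢0-pos 0<z z≡0 = ℤP.<-irrefl (sym z≡0) 0<z
    ≢0-neg : ∀ {z} → z < 0ℤ → z ≢ 0ℤ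
    ≢0-neg z<0 z≡0 = ℤP.<-irrefl z≡0 z<0
    not-parallel : ∀ {e} → Shape I e → det 𝔩 (dir e) ≢ 0ℤ
    not-parallel {e} e-shape with shape-slope e-shape
    ... | inj₁ e-asc  = ≢0-pos (det-𝔩-level>0 (hd e) (tl e) e-asc)
    ... | inj₂ e-desc = ≢0-neg (det-𝔩-level<0 (hd e) (tl e) e-desc)
    off-ray : ∀ a v → internal v ≡ true → det (pos v -v pos (bnd a)) 𝔩 ≢ 0ℤ
    off-ray a v v-int = ≢0-neg (det-level<0 v (bnd a) (bnd-below a v v-int))

  windIn-from-bw : ∀ {i j} e → tl e ≡ wht i j → proj₂ (dir e) ≤ 0ℤ → windIn I G 𝔩 e ≡ + 0
  windIn-from-bw {i} {j} e tl≡wht e↓ =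
    windIn-≡0 I G 𝔩 e λ e₁ e₁↦e → from-bw e₁ (subst (λ v → T (hd e₁ ==V v)) tl≡wht e₁↦e)
    where
    from-bw : ∀ e₁ → T (hd e₁ ==V wht i j) → wind 𝔩 (dir e₁) (dir e) ≡ + 0
    from-bw (bw p q)    _ = wind-from-bw p q (dir e) e↓
    from-bw (src _)     ()
    from-bw (hor _ _ _) ()
    from-bw (ver _ _ _) ()
    from-bw (snk _ _)   ()

  windOut-to-bw : ∀ {i j} e → hd e ≡ blk i j →
    (∀ p q → wind 𝔩 (dir e) (dir (bw p q)) ≡ + 0) → windOut I G 𝔩 e ≡ + 0
  windOut-to-bw {i} {j} e hd≡blk into-bw = windOut-≡0 I G 𝔩 (leEdges-shape I L) e
    λ e₅ e₅-shape e↦e₅ → to-bw e₅-shape (subst (λ v → T (tl e₅ ==V v)) hd≡blk e↦e₅)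
    where
    to-bw : ∀ {e₅} → Shape I e₅ → T (tl e₅ ==V blk i j) → wind 𝔩 (dir e) (dir e₅) ≡ + 0
    to-bw (bw p q)  _ = into-bw p q
    to-bw (src _)   ()
    to-bw (horV _)  ()
    to-bw (horW _)  ()
    to-bw (ver _)   ()
    to-bw (snk _ _) ()

  geoSig≡master+η : ∀ {e} → Shape I e → geoSig I G 𝔩 e ≡ (master I e xor ηᵇ (tl e)) xor ηᵇ (hd e)
  geoSig≡master+η (src i) = cong (λ z → odd ∣ + 1 + z ∣) (intE-src I G i)
  geoSig≡master+η (bw i j) =
    trans (cong (odd ∘ ∣_∣) (intE-internal I G (bw i j) refl refl)) (sym (xor-same (not (c i))))
  geoSig≡master+η (horV {i} {j} i<j) = trans
    (odd∣1+0+0+0∣ (intE-internal I G e refl refl)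
      (windIn-≡0 I G 𝔩 e λ where
        (src i′)    _ → wind-from-src-to-horV i′ i<j
        (bw _ _)    ()
        (hor _ _ _) ()
        (ver _ _ _) ()
        (snk _ _)   ())
      (windOut-to-bw e refl λ p q →
        wind-ascending-to-bw e p q (ℤP.≤-reflexive (sym e-flat)) (horV-ascends i<j)))
    (sym (not-xor-self (c i)))
    where
    e = hor (vI i) i j
    e-flat : proj₂ (dir e) ≡ 0ℤ
    e-flat = ℤP.+-inverseʳ (+ (n ∸ toℕ i))
  geoSig≡master+η (horW {i} {l} {j} l<j) = trans
    (odd∣1+0+0+0∣ (intE-internal I G e refl refl)
      (windIn-from-bw e refl (ℤP.≤-reflexive e-flat))
      (windOut-to-bw e refl λ p q →
        wind-ascending-to-bw e p q (ℤP.≤-reflexive (sym e-flat)) (horW-ascends {i} {l} {j} l<j)))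
    (sym (not-xor-self (c i)))
    where
    e = hor (wht i l) i j
    e-flat : proj₂ (dir e) ≡ 0ℤ
    e-flat = ℤP.+-inverseʳ (+ (n ∸ toℕ i))
  geoSig≡master+η (ver {i} {l} {j} i<l) = trans
    (odd∣1+0+0+0∣ (intE-internal I G e refl refl)
      (windIn-from-bw e refl e↓)
      (windOut-to-bw e refl λ p q → wind-descending-to-bw e p q e↓ (ver-descends {i} {l} {j} i<l)))
    (sym (begin
      (M xor not (c i)) xor c l         ≡⟨ cong (λ x → (M xor not x) xor c l) (sourceParity-split≤ I i<l) ⟩
      (M xor not (M xor c l)) xor c l   ≡⟨ cong (_xor c l) (xor-not-xor M (c l)) ⟩
      not (c l) xor c l                 ≡⟨ not-xor-self (c l) ⟩
      true                              ∎))
    where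
    e = ver i l j
    M = master I e
    e↓ : proj₂ (dir e) ≤ 0ℤ
    e↓ = ℤP.i≤j⇒i-j≤0 (+≤+ (ℕP.∸-monoʳ-≤ n (ℕP.<⇒≤ i<l)))
  geoSig≡master+η (snk {i} {j} i<j j∉I) = begin
    odd ∣ + 1 + intE I G 𝔩 e + windIn I G 𝔩 e ∣
      ≡⟨ cong₂ (λ x y → odd ∣ + 1 + x + y ∣) (intE-snk I G i j) (windIn-from-bw e refl e↓) ⟩
    odd ∣ + 1 - + sourcesAfter I j + + 0 ∣
      ≡⟨ cong (odd ∘ ∣_∣) (ℤP.+-identityʳ (+ 1 - + sourcesAfter I j)) ⟩
    odd ∣ + 1 - + sourcesAfter I j ∣
      ≡⟨ odd∣1-c∣ (sourcesAfter I j) ⟩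
    not (c j)
      ≡⟨ xor-not-xor M (c j) ⟨
    M xor not (M xor c j)
      ≡⟨ cong (λ x → M xor not x) (sourceParity-split< I i<j j∉I) ⟨
    M xor not (c i)
      ≡⟨ xor-identityʳ _ ⟨
    (M xor not (c i)) xor false
      ∎
    where
    e = snk i j
    M = master I e
    e↓ : proj₂ (dir e) ≤ 0ℤ
    e↓ = ℤP.i≤j⇒i-j≤0 (+≤+ (ℕ.z≤n {n ∸ toℕ i}))

mainTheorem3 : (n : ℕ) (I : Fin n → Bool) (L : Fin n → Fin n → Bool) →
    IsLeDiagram I L →
    Σ Vec2 λ 𝔩 → IsGaugeDir I (leEdges I L) 𝔩 ×
    SigEquiv (leEdges I L) (master I) (geoSig I (leEdges I L) 𝔩)
mainTheorem3 n I L _ =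
  gaugeDir n , gaugeDir-isGaugeDir I L , η I , All.map (geoSig≡master+η I L) (leEdges-shape I L)
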